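{- Let $G$ be a $2$-good graph on $n$ vertices such that $3 \mid e(G)$. Then $R(G, \mathbb{Z}_3) \leq n + 2$.
   Context: A graph $G$ (not necessarily connected) is $2$-good if it has at least $2$ vertices of degree $1$ that are pairwise at distance at least three apart (vertices in different components are at infinite distance). For a graph $G$ on $n$ vertices with $3 \mid e(G)$, the zero-sum Ramsey number $R(G, \mathbb{Z}_3)$ is the smallest positive integer such that for every $N \geq R(G,\mathbb{Z}_3)$ and every edge-colouring $f\colon E(K_N) \to \mathbb{Z}_3$, there is a subgraph of $K_N$ isomorphic to $G$ (a copy of $G$) whose edges satisfy $\sum_{e \in E(G)} f(e) \equiv 0 \pmod 3$ (a zero-sum copy). -}

module Defs where

open import Data.Nat using (ℕ; zero; suc; _+_; _<_; _≥_; _%_)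
open import Data.Nat.Properties using (_<?_)
open import Data.Bool using (Bool; true; false; if_then_else_)
open import Data.Fin using (Fin; toℕ)
open import Data.Nat.ListAction using (sum)
open import Data.List using (List; map; length; filterᵇ; allFin)
open import Data.Product using (Σ; _×_; _,_; ∃)
open import Relation.Nullary using (¬_; does)
open import Relation.Binary.PropositionalEquality using (_≡_; _≢_)
open import Function.Definitions using (Injective)

record SimpleGraph (n : ℕ) : Set where
  field
    adj    : Fin n → Fin n → Bool
    sym    : ∀ u v → adj u v ≡ adj v u
    irrefl : ∀ v → adj v v ≡ false
open SimpleGraph public

edgeSum : ∀ {n} → SimpleGraph n → (Fin n → Fin n → ℕ) → ℕ
edgeSum {n} G w =
  sum (map (λ u → sum (map (λ v →
        if does (toℕ u <? toℕ v) then (if adj G u v then w u v else 0) else 0)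
      (allFin n))) (allFin n))

e : ∀ {n} → SimpleGraph n → ℕ
e G = edgeSum G (λ _ _ → 1)

degree : ∀ {n} → SimpleGraph n → Fin n → ℕ
degree {n} G u = length (filterᵇ (adj G u) (allFin n))

-- distance between u and v is at least three: u ≠ v, not adjacent,
-- and no common neighbour (vertices in different components qualify)
DistAtLeast3 : ∀ {n} → SimpleGraph n → Fin n → Fin n → Set
DistAtLeast3 {n} G u v =
  u ≢ v × adj G u v ≡ false × (∀ w → ¬ (adj G u w ≡ true × adj G w v ≡ true))

TwoGood : ∀ {n} → SimpleGraph n → Set
TwoGood G = Σ _ λ u → Σ _ λ v →
  degree G u ≡ 1 × degree G v ≡ 1 × DistAtLeast3 G u v

-- an edge-colouring of K_N with values in ℤ₃ (symmetric function; diagonal unused)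
record Colouring (N : ℕ) : Set where
  field
    col    : Fin N → Fin N → Fin 3
    colSym : ∀ i j → col i j ≡ col j i
open Colouring public

ZeroSumCopy : ∀ {n N} → SimpleGraph n → Colouring N → Set
ZeroSumCopy {n} {N} G c =
  Σ (Fin n → Fin N) λ φ → Injective _≡_ _≡_ φ ×
    (edgeSum G (λ u v → toℕ (col c (φ u) (φ v))) % 3 ≡ 0)

-- R(G, ℤ₃) ≤ m, unfolded: every N ≥ m and every ℤ₃-colouring of K_N
-- admits a zero-sum copy of G
ZeroSumRamseyAtMost : ∀ {n} → SimpleGraph n → ℕ → Set
ZeroSumRamseyAtMost G m = ∀ N → N ≥ m → (c : Colouring N) → ZeroSumCopy G c

-- Let u and v be leaves of G at distance at least three, with neighbours u′ and v′; then
-- n ≥ 4 and so N ≥ 6.  A colouring of K_N on at least six vertices either becomes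
-- monochromatic after deleting some two vertices s and t, or has two vertex-disjoint cherries
-- e₁c₁e₁′ and e₂c₂e₂′ each of whose two edges have different colours.  In the first case
-- every copy of G avoiding s and t has colour sum α·e(G) ≡ 0.  In the second, embed G with
-- u′ ↦ c₁, u ↦ e₁, v′ ↦ c₂, v ↦ e₂, leaving e₁′ and e₂′ unused.  Moving u to e₁′ and/or v to
-- e₂′ recolours only the pendant edges uu′ and vv′, so the four copies have colour sums S,
-- S + d, S + d′ and S + d + d′ with d, d′ ≢ 0 (mod 3), and one of them is 0 (mod 3).

{-# OPTIONS --safe #-}
module Submission where

open import Defs
open import Data.Nat using (ℕ; _+_; _%_)
open import Relation.Binary.PropositionalEquality using (_≡_)

open import Data.Nat.Properties
  using (+-*-semiring; <ᵇ⇒<; <⇒<ᵇ; +-assoc; +-comm; +-cancelʳ-≡; *-zeroʳ; *-identityʳ; <-cmp; <-asym;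
         <⇒≱; <-≤-trans; ≤-trans)
open import Algebra.Properties.Semiring.Sum +-*-semiring
  using (sum-cong-≗; *-distribˡ-sum) renaming (sum to ∑)
open import Data.Bool using (true; false; T?; if_then_else_)
open import Data.Bool.Properties using (T-≡)
open import Data.Fin using (Fin; zero; suc; toℕ; inject≤; _↑ʳ_)
open import Data.Fin.Patterns using (0F; 1F; 2F; 3F; 4F; 5F)
open import Data.Fin.Permutation.Components using (transpose; transpose-inverse)
open import Data.Fin.Properties
  using (_≟_; any?; toℕ-injective; suc-injective; inject≤-injective; ↑ʳ-injective; injective⇒≤)
import Data.List as List
open import Data.List using (List; []; _∷_; length; filterᵇ)
open import Data.List.Membership.Propositional using (_∈_)
open import Data.List.Membership.Propositional.Properties using (∈-filter⁻; ∈-filter⁺; ∈-allFin)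
open import Data.List.Properties using (map-tabulate)
open import Data.List.Relation.Unary.Any using (here)
open import Data.Nat using (zero; suc; _*_; _<_; _≤_; s≤s; _<?_; _<ᵇ_)
open import Data.Nat.DivMod using (%-distribˡ-+; [m+kn]%n≡m%n; m%n<n)
open import Data.Nat.Divisibility using (m%n≡0⇒n∣m; n∣m⇒m%n≡0; ∣n⇒∣m*n)
open import Data.Nat.ListAction using (sum)
open import Data.Nat.Tactic.RingSolver using (solve-∀)
open import Data.Product using (∃; ∃-syntax; ∃₂; _×_; _,_; proj₁; proj₂)
open import Data.Sum using (_⊎_; inj₁; inj₂; [_,_]′)
import Data.Sum as Sum
open import Data.Vec using (Vec; []; _∷_; lookup; map)
open import Data.Vec.Functional using (updateAt)
open import Data.Vec.Functional.Properties using (updateAt-updates; updateAt-minimal)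
open import Data.Vec.Properties using (lookup-map)
open import Data.Vec.Relation.Unary.All using (All; []; _∷_; all?; universal)
open import Data.Vec.Relation.Unary.All.Properties using (lookup⁺; lookup⁻) renaming (map⁺ to All-map⁺)
open import Data.Vec.Relation.Unary.AllPairs using (allPairs?; []; _∷_)
open import Data.Vec.Relation.Unary.Unique.Propositional using (Unique)
open import Data.Vec.Relation.Unary.Unique.Propositional.Properties
  using (lookup-injective) renaming (map⁺ to Unique-map⁺)
open import Function using (_∘_; id; const; Injective; Equivalence)
open import Relation.Binary.Definitions using (DecidableEquality; tri<; tri≈; tri>)
open import Relation.Binary.PropositionalEquality
  using (_≢_; refl; trans; cong; cong₂; subst; subst₂; ≢-sym; module ≡-Reasoning)
import Relation.Binary.PropositionalEquality as ≡
open import Relation.Nullary using (¬_; Dec; does; yes; no; ¬?; contradiction)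
open import Relation.Nullary.Decidable
  using (True; toWitness; dec-true; dec-false; decidable-stable; _×-dec_)
open import Relation.Unary using (Decidable)

sum-allFin : ∀ {n} (f : Fin n → ℕ) → sum (List.map f (List.allFin n)) ≡ ∑ f
sum-allFin {zero} f = refl
sum-allFin {suc n} f = cong (f zero +_) (begin
  sum (List.map f (List.tabulate suc))       ≡⟨ cong sum (map-tabulate suc f) ⟩
  sum (List.tabulate (f ∘ suc))              ≡⟨ cong sum (map-tabulate id (f ∘ suc)) ⟨
  sum (List.map (f ∘ suc) (List.allFin n))   ≡⟨ sum-allFin (f ∘ suc) ⟩
  ∑ (f ∘ suc)                                ∎)
  where open ≡-Reasoning

∑-update : ∀ {n} {f g : Fin n → ℕ} k → (∀ i → i ≢ k → f i ≡ g i) → ∑ f + g k ≡ ∑ g + f k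
∑-update {suc _} {f} {g} zero agree = begin
  (f zero + ∑ (f ∘ suc)) + g zero  ≡⟨ cong (λ s → (f zero + s) + g zero) rest ⟩
  (f zero + ∑ (g ∘ suc)) + g zero  ≡⟨ swap-ends (f zero) (∑ (g ∘ suc)) (g zero) ⟩
  (g zero + ∑ (g ∘ suc)) + f zero  ∎
  where
  open ≡-Reasoning
  rest : ∑ (f ∘ suc) ≡ ∑ (g ∘ suc)
  rest = sum-cong-≗ λ i → agree (suc i) λ ()
  swap-ends : ∀ a s b → (a + s) + b ≡ (b + s) + a
  swap-ends = solve-∀
∑-update {suc _} {f} {g} (suc k) agree = begin
  (f zero + ∑ (f ∘ suc)) + g (suc k) ≡⟨ +-assoc (f zero) _ _ ⟩
  f zero + (∑ (f ∘ suc) + g (suc k)) ≡⟨ cong₂ _+_ (agree zero λ ()) rest ⟩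
  g zero + (∑ (g ∘ suc) + f (suc k)) ≡⟨ +-assoc (g zero) _ _ ⟨
  (g zero + ∑ (g ∘ suc)) + f (suc k) ∎
  where
  open ≡-Reasoning
  rest : ∑ (f ∘ suc) + g (suc k) ≡ ∑ (g ∘ suc) + f (suc k)
  rest = ∑-update k λ i i≢k → agree (suc i) (i≢k ∘ suc-injective)

-- m − n = o − p = r − q, with the subtractions moved across.
exchange-cancel : ∀ {m n o p q r : ℕ} → m + p ≡ n + o → o + q ≡ p + r → m + q ≡ n + r
exchange-cancel {m} {n} {o} {p} {q} {r} eq₁ eq₂ = +-cancelʳ-≡ (o + p) (m + q) (n + r) (begin
  (m + q) + (o + p)  ≡⟨ shuffle₁ m q o p ⟩
  (m + p) + (o + q)  ≡⟨ cong₂ _+_ eq₁ eq₂ ⟩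
  (n + o) + (p + r)  ≡⟨ shuffle₂ n o p r ⟩
  (n + r) + (o + p)  ∎)
  where
  open ≡-Reasoning
  shuffle₁ : ∀ a b c d → (a + b) + (c + d) ≡ (a + d) + (c + b)
  shuffle₁ = solve-∀
  shuffle₂ : ∀ a b c d → (a + b) + (c + d) ≡ (a + d) + (b + c)
  shuffle₂ = solve-∀

∑∑-update : ∀ {m n} {f g : Fin m → Fin n → ℕ} a b → (∀ i j → ¬ (i ≡ a × j ≡ b) → f i j ≡ g i j) →
            ∑ (λ i → ∑ (f i)) + g a b ≡ ∑ (λ i → ∑ (g i)) + f a b
∑∑-update {f = f} {g} a b agree = exchange-cancel {o = ∑ (f a)} {p = ∑ (g a)} rows row-a
  where
  rows : ∑ (λ i → ∑ (f i)) + ∑ (g a) ≡ ∑ (λ i → ∑ (g i)) + ∑ (f a)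
  rows = ∑-update a λ i i≢a → sum-cong-≗ λ j → agree i j (i≢a ∘ proj₁)
  row-a : ∑ (f a) + g a b ≡ ∑ (g a) + f a b
  row-a = ∑-update b λ j j≢b → agree a j (j≢b ∘ proj₂)

-- n = m + (b − a), and −a ≡ 2a modulo 3.
m+b≡n+a⇒n%3≡[m+b+2a]%3 : ∀ m n a b → m + b ≡ n + a → n % 3 ≡ (m + (b + 2 * a)) % 3
m+b≡n+a⇒n%3≡[m+b+2a]%3 m n a b eq = begin
  n % 3                  ≡⟨ [m+kn]%n≡m%n n a 3 ⟨
  (n + a * 3) % 3        ≡⟨ cong (_% 3) (regroup n a) ⟩
  ((n + a) + 2 * a) % 3  ≡⟨ cong (λ s → (s + 2 * a) % 3) eq ⟨
  ((m + b) + 2 * a) % 3  ≡⟨ cong (_% 3) (+-assoc m b (2 * a)) ⟩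
  (m + (b + 2 * a)) % 3  ∎
  where
  open ≡-Reasoning
  regroup : ∀ n a → n + a * 3 ≡ (n + a) + 2 * a
  regroup = solve-∀

≢⇒[b+2a]%3≢0 : ∀ {a b : Fin 3} → a ≢ b → (toℕ b + 2 * toℕ a) % 3 ≢ 0
≢⇒[b+2a]%3≢0 {0F} {0F} a≢b = contradiction refl a≢b
≢⇒[b+2a]%3≢0 {1F} {1F} a≢b = contradiction refl a≢b
≢⇒[b+2a]%3≢0 {2F} {2F} a≢b = contradiction refl a≢b
≢⇒[b+2a]%3≢0 {0F} {1F} _ ()
≢⇒[b+2a]%3≢0 {0F} {2F} _ ()
≢⇒[b+2a]%3≢0 {1F} {0F} _ ()
≢⇒[b+2a]%3≢0 {1F} {2F} _ ()
≢⇒[b+2a]%3≢0 {2F} {0F} _ ()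
≢⇒[b+2a]%3≢0 {2F} {1F} _ ()

private
  residue-cases : ∀ r d d′ → r < 3 → d < 3 → d′ < 3 → d ≢ 0 → d′ ≢ 0 →
    r ≡ 0 ⊎ (r + d) % 3 ≡ 0 ⊎ (r + d′) % 3 ≡ 0 ⊎ ((r + d) % 3 + d′) % 3 ≡ 0
  residue-cases 0 _ _ _ _ _ _ _ = inj₁ refl
  residue-cases _ 0 _ _ _ _ d≢0 _ = contradiction refl d≢0
  residue-cases _ _ 0 _ _ _ _ d′≢0 = contradiction refl d′≢0
  residue-cases 1 2 _ _ _ _ _ _ = inj₂ (inj₁ refl)
  residue-cases 2 1 _ _ _ _ _ _ = inj₂ (inj₁ refl)
  residue-cases 1 1 2 _ _ _ _ _ = inj₂ (inj₂ (inj₁ refl))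
  residue-cases 2 2 1 _ _ _ _ _ = inj₂ (inj₂ (inj₁ refl))
  residue-cases 1 1 1 _ _ _ _ _ = inj₂ (inj₂ (inj₂ refl))
  residue-cases 2 2 2 _ _ _ _ _ = inj₂ (inj₂ (inj₂ refl))
  residue-cases (suc (suc (suc _))) _ _ (s≤s (s≤s (s≤s ()))) _ _ _ _
  residue-cases _ (suc (suc (suc _))) _ _ (s≤s (s≤s (s≤s ()))) _ _ _
  residue-cases _ _ (suc (suc (suc _))) _ _ (s≤s (s≤s (s≤s ()))) _ _

zeroSum-among-four : ∀ {S₀ S₁ S₂ S₃} {a a′ b b′ : Fin 3} → a ≢ a′ → b ≢ b′ →
  S₀ + toℕ a′ ≡ S₁ + toℕ a → S₀ + toℕ b′ ≡ S₂ + toℕ b → S₁ + toℕ b′ ≡ S₃ + toℕ b →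
  S₀ % 3 ≡ 0 ⊎ S₁ % 3 ≡ 0 ⊎ S₂ % 3 ≡ 0 ⊎ S₃ % 3 ≡ 0
zeroSum-among-four {S₀} {S₁} {S₂} {S₃} {a} {a′} {b} {b′} a≢a′ b≢b′ move₁ move₂ move₃ =
  Sum.map₂ (Sum.map (trans S₁-residue) (Sum.map (trans S₂-residue) (trans S₃-residue)))
    (residue-cases (S₀ % 3) (d % 3) (d′ % 3) (m%n<n S₀ 3) (m%n<n d 3) (m%n<n d′ 3)
                   (≢⇒[b+2a]%3≢0 a≢a′) (≢⇒[b+2a]%3≢0 b≢b′))
  where
  open ≡-Reasoning
  d d′ : ℕ
  d = toℕ a′ + 2 * toℕ a
  d′ = toℕ b′ + 2 * toℕ b
  S₁-residue : S₁ % 3 ≡ (S₀ % 3 + d % 3) % 3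
  S₁-residue = trans (m+b≡n+a⇒n%3≡[m+b+2a]%3 S₀ S₁ (toℕ a) (toℕ a′) move₁) (%-distribˡ-+ S₀ d 3)
  S₂-residue : S₂ % 3 ≡ (S₀ % 3 + d′ % 3) % 3
  S₂-residue = trans (m+b≡n+a⇒n%3≡[m+b+2a]%3 S₀ S₂ (toℕ b) (toℕ b′) move₂) (%-distribˡ-+ S₀ d′ 3)
  S₃-residue : S₃ % 3 ≡ ((S₀ % 3 + d % 3) % 3 + d′ % 3) % 3
  S₃-residue = begin
    S₃ % 3                              ≡⟨ m+b≡n+a⇒n%3≡[m+b+2a]%3 S₁ S₃ (toℕ b) (toℕ b′) move₃ ⟩
    (S₁ + d′) % 3                       ≡⟨ %-distribˡ-+ S₁ d′ 3 ⟩
    (S₁ % 3 + d′ % 3) % 3               ≡⟨ cong (λ s → (s + d′ % 3) % 3) S₁-residue ⟩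
    ((S₀ % 3 + d % 3) % 3 + d′ % 3) % 3 ∎

Unique-select : ∀ {A : Set} {n m} {xs : Vec A n} → Unique xs → (π : Vec (Fin n) m) →
                {True (allPairs? (λ i j → ¬? (i ≟ j)) π)} → Unique (map (lookup xs) π)
Unique-select xs-distinct π {π-distinct} =
  Unique-map⁺ (λ {i} {j} → lookup-injective xs-distinct i j) (toWitness π-distinct)

fresh : ∀ {k N} (xs : Vec (Fin N) k) → k < N → ∃[ y ] All (y ≢_) xs
fresh xs k<N with any? (λ y → all? (λ x → ¬? (y ≟ x)) xs)
... | yes found = found
... | no none = contradiction (injective⇒≤ position-injective) (<⇒≱ k<N)
  where
  position : ∀ y → ∃[ i ] lookup xs i ≡ y
  position y with any? (λ i → lookup xs i ≟ y)
  ... | yes found = found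
  ... | no absent = contradiction (y , lookup⁻ λ i y≡xᵢ → absent (i , ≡.sym y≡xᵢ)) none
  position-injective : Injective _≡_ _≡_ (proj₁ ∘ position)
  position-injective {y} {y′} same =
    trans (≡.sym (proj₂ (position y))) (trans (cong (lookup xs) same) (proj₂ (position y′)))

transpose-left : ∀ {n} (i j : Fin n) → transpose i j i ≡ j
transpose-left i j rewrite dec-true (i ≟ i) refl = refl

transpose-other : ∀ {n} {i j k : Fin n} → k ≢ i → k ≢ j → transpose i j k ≡ k
transpose-other {i = i} {j} {k} k≢i k≢j rewrite dec-false (k ≟ i) k≢i | dec-false (k ≟ j) k≢j = refl

transpose-injective : ∀ {n} (i j : Fin n) → Injective _≡_ _≡_ (transpose i j)
transpose-injective i j eq =
  trans (≡.sym (transpose-inverse j i)) (trans (cong (transpose j i) eq) (transpose-inverse j i))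

extendInjection : ∀ {k m N} → m ≤ N → (xs : Vec (Fin m) k) → Unique xs →
                  (ys : Vec (Fin N) k) → Unique ys →
                  ∃[ Φ ] Injective _≡_ _≡_ Φ × (∀ i → Φ (lookup xs i) ≡ lookup ys i)
extendInjection m≤N [] [] [] [] =
  (λ i → inject≤ i m≤N) , (λ {i} {j} → inject≤-injective m≤N m≤N i j) , λ ()
extendInjection m≤N (x ∷ xs) (x∉xs ∷ xs-distinct) (y ∷ ys) (y∉ys ∷ ys-distinct)
  with extendInjection m≤N xs xs-distinct ys ys-distinct
... | Φ , Φ-injective , Φ-spec = transpose (Φ x) y ∘ Φ , Φ-injective ∘ transpose-injective (Φ x) y , spec
  where
  spec : ∀ i → transpose (Φ x) y (Φ (lookup (x ∷ xs) i)) ≡ lookup (y ∷ ys) i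
  spec zero = transpose-left (Φ x) y
  spec (suc i) =
    trans (cong (transpose (Φ x) y) (Φ-spec i)) (transpose-other yᵢ≢Φx (≢-sym (lookup⁺ y∉ys i)))
    where
    yᵢ≢Φx : lookup ys i ≢ Φ x
    yᵢ≢Φx yᵢ≡Φx = lookup⁺ x∉xs i (≡.sym (Φ-injective (trans (Φ-spec i) yᵢ≡Φx)))

spares-distinct : ∀ {k n} {xs : Vec (Fin n) k} → Unique xs → Unique (zero ∷ suc zero ∷ map (2 ↑ʳ_) xs)
spares-distinct {xs = xs} xs-distinct =
  ((λ ()) ∷ All-map⁺ (universal (λ _ ()) xs)) ∷ All-map⁺ (universal (λ _ ()) xs)
  ∷ Unique-map⁺ (↑ʳ-injective 2 _ _) xs-distinct

EmbeddingAvoiding : ∀ {k n N} → Vec (Fin n) k → (s t : Fin N) → Vec (Fin N) k → Set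
EmbeddingAvoiding xs s t ys =
  ∃[ φ ] Injective _≡_ _≡_ φ × (∀ i → φ (lookup xs i) ≡ lookup ys i) × (∀ i → φ i ≢ s) × (∀ i → φ i ≢ t)

embedAvoiding : ∀ {k n N} → 2 + n ≤ N → (xs : Vec (Fin n) k) → Unique xs →
  (s t : Fin N) (ys : Vec (Fin N) k) → Unique (s ∷ t ∷ ys) → EmbeddingAvoiding xs s t ys
embedAvoiding 2+n≤N xs xs-distinct s t ys targets-distinct
  with extendInjection 2+n≤N (zero ∷ suc zero ∷ map (2 ↑ʳ_) xs) (spares-distinct xs-distinct)
                             (s ∷ t ∷ ys) targets-distinct
... | Φ , Φ-injective , Φ-spec =
  Φ ∘ (2 ↑ʳ_) , ↑ʳ-injective 2 _ _ ∘ Φ-injective , spec , avoids-s , avoids-t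
  where
  spec : ∀ i → Φ (2 ↑ʳ lookup xs i) ≡ lookup ys i
  spec i = trans (cong Φ (≡.sym (lookup-map i (2 ↑ʳ_) xs))) (Φ-spec (suc (suc i)))
  avoids-s : ∀ i → Φ (2 ↑ʳ i) ≢ s
  avoids-s i Φi≡s with () ← Φ-injective (trans Φi≡s (≡.sym (Φ-spec zero)))
  avoids-t : ∀ i → Φ (2 ↑ʳ i) ≢ t
  avoids-t i Φi≡t with () ← Φ-injective (trans Φi≡t (≡.sym (Φ-spec (suc zero))))

updateAt-injective : ∀ {n N} {φ : Fin n → Fin N} {u y} → Injective _≡_ _≡_ φ → (∀ i → φ i ≢ y) →
                     Injective _≡_ _≡_ (updateAt φ u (const y))
updateAt-injective {φ = φ} {u} φ-injective φ≢y {i} {j} eq with i ≟ u | j ≟ u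
... | yes refl | yes refl = refl
... | yes refl | no j≢u =
  contradiction (trans (≡.sym (updateAt-minimal j u φ j≢u)) (trans (≡.sym eq) (updateAt-updates u φ))) (φ≢y j)
... | no i≢u | yes refl =
  contradiction (trans (≡.sym (updateAt-minimal i u φ i≢u)) (trans eq (updateAt-updates u φ))) (φ≢y i)
... | no i≢u | no j≢u =
  φ-injective (trans (≡.sym (updateAt-minimal i u φ i≢u)) (trans eq (updateAt-minimal j u φ j≢u)))

updateAt-avoids : ∀ {n N} {φ : Fin n → Fin N} {u y z} → (∀ i → φ i ≢ z) → y ≢ z →
                  ∀ i → updateAt φ u (const y) i ≢ z
updateAt-avoids {φ = φ} {u} φ≢z y≢z i with i ≟ u
... | yes refl = subst (_≢ _) (≡.sym (updateAt-updates u φ)) y≢z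
... | no i≢u = subst (_≢ _) (≡.sym (updateAt-minimal i u φ i≢u)) (φ≢z i)

length≡1⇒singleton : ∀ {A : Set} (xs : List A) → length xs ≡ 1 → ∃[ x ] xs ≡ x ∷ []
length≡1⇒singleton (x ∷ []) refl = x , refl

Pendant : ∀ {n} → SimpleGraph n → Fin n → Fin n → Set
Pendant G u u′ = adj G u u′ ≡ true × (∀ j → adj G u j ≡ true → j ≡ u′)

module _ {n} (G : SimpleGraph n) where

  adjacent≢nonadjacent : ∀ {i j k} → adj G i j ≡ true → adj G i k ≡ false → j ≢ k
  adjacent≢nonadjacent adjᵢⱼ ¬adjᵢₖ refl = contradiction (trans (≡.sym adjᵢⱼ) ¬adjᵢₖ) λ ()

  adjacent⇒≢ : ∀ {i j} → adj G i j ≡ true → i ≢ j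
  adjacent⇒≢ {i} adjᵢⱼ = ≢-sym (adjacent≢nonadjacent adjᵢⱼ (irrefl G i))

  degree≡1⇒pendant : ∀ {u} → degree G u ≡ 1 → ∃ (Pendant G u)
  degree≡1⇒pendant {u} deg with length≡1⇒singleton (filterᵇ (adj G u) (List.allFin n)) deg
  ... | u′ , neighbours≡[u′] = u′ , adjacent , only
    where
    adjacent : adj G u u′ ≡ true
    adjacent = Equivalence.to T-≡ (proj₂ (∈-filter⁻ (T? ∘ adj G u) {xs = List.allFin n}
                                              (subst (u′ ∈_) (≡.sym neighbours≡[u′]) (here refl))))
    only : ∀ j → adj G u j ≡ true → j ≡ u′
    only j adjᵤⱼ with subst (j ∈_) neighbours≡[u′]
                        (∈-filter⁺ (T? ∘ adj G u) (∈-allFin j) (Equivalence.from T-≡ adjᵤⱼ))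
    ... | here j≡u′ = j≡u′

  leaves-distinct : ∀ {u u′ v v′} → Pendant G u u′ → Pendant G v v′ → DistAtLeast3 G u v →
                    Unique (u ∷ u′ ∷ v ∷ v′ ∷ [])
  leaves-distinct {u} {u′} {v} {v′} (adj-uu′ , _) (adj-vv′ , _) (u≢v , ¬adj-uv , no-common-neighbour) =
    (≢-sym u′≢u ∷ u≢v ∷ ≢-sym v′≢u ∷ []) ∷ (u′≢v ∷ u′≢v′ ∷ []) ∷ (≢-sym v′≢v ∷ []) ∷ [] ∷ []
    where
    u′≢u : u′ ≢ u
    u′≢u = adjacent≢nonadjacent adj-uu′ (irrefl G u)
    u′≢v : u′ ≢ v
    u′≢v = adjacent≢nonadjacent adj-uu′ ¬adj-uv
    v′≢u : v′ ≢ u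
    v′≢u = adjacent≢nonadjacent adj-vv′ (trans (sym G v u) ¬adj-uv)
    v′≢v : v′ ≢ v
    v′≢v = adjacent≢nonadjacent adj-vv′ (irrefl G v)
    u′≢v′ : u′ ≢ v′
    u′≢v′ refl = no-common-neighbour u′ (adj-uu′ , trans (sym G u′ v) adj-vv′)

  edgeTerm : (Fin n → Fin n → ℕ) → Fin n → Fin n → ℕ
  edgeTerm w i j = if does (toℕ i <? toℕ j) then (if adj G i j then w i j else 0) else 0

  edgeSum≡∑∑ : ∀ w → edgeSum G w ≡ ∑ λ i → ∑ (edgeTerm w i)
  edgeSum≡∑∑ w = trans (sum-allFin (λ i → sum (List.map (edgeTerm w i) (List.allFin n))))
                       (sum-cong-≗ λ i → sum-allFin (edgeTerm w i))

  edgeTerm-cong : ∀ {w w′} i j → (toℕ i < toℕ j → adj G i j ≡ true → w i j ≡ w′ i j) →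
                  edgeTerm w i j ≡ edgeTerm w′ i j
  edgeTerm-cong i j agree with toℕ i <ᵇ toℕ j in order
  ... | false = refl
  ... | true with adj G i j
  ...   | true = agree (<ᵇ⇒< (toℕ i) (toℕ j) (Equivalence.from T-≡ order)) refl
  ...   | false = refl

  edgeTerm-edge : ∀ {w x y} → toℕ x < toℕ y → adj G x y ≡ true → edgeTerm w x y ≡ w x y
  edgeTerm-edge x<y adjₓᵧ rewrite Equivalence.to T-≡ (<⇒<ᵇ x<y) | adjₓᵧ = refl

  edgeSum-constant : ∀ {w} k → (∀ i j → adj G i j ≡ true → w i j ≡ k) → edgeSum G w ≡ k * e G
  edgeSum-constant {w} k constant = begin
    edgeSum G w                            ≡⟨ edgeSum≡∑∑ w ⟩
    ∑ (λ i → ∑ (edgeTerm w i))             ≡⟨ sum-cong-≗ (λ i → sum-cong-≗ (scaled i)) ⟩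
    ∑ (λ i → ∑ (λ j → k * edgeTerm one i j)) ≡⟨ sum-cong-≗ (λ i → *-distribˡ-sum k (edgeTerm one i)) ⟨
    ∑ (λ i → k * ∑ (edgeTerm one i))       ≡⟨ *-distribˡ-sum k (λ i → ∑ (edgeTerm one i)) ⟨
    k * ∑ (λ i → ∑ (edgeTerm one i))       ≡⟨ cong (k *_) (edgeSum≡∑∑ one) ⟨
    k * e G                                ∎
    where
    open ≡-Reasoning
    one : Fin n → Fin n → ℕ
    one _ _ = 1
    scaled : ∀ i j → edgeTerm w i j ≡ k * edgeTerm one i j
    scaled i j with toℕ i <ᵇ toℕ j
    ... | false = ≡.sym (*-zeroʳ k)
    ... | true with adj G i j in adjᵢⱼ
    ...   | true = trans (constant i j adjᵢⱼ) (≡.sym (*-identityʳ k))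
    ...   | false = ≡.sym (*-zeroʳ k)

  private
    edgeSum-update-ordered : ∀ {w w′ x y} → toℕ x < toℕ y → adj G x y ≡ true →
      (∀ i j → adj G i j ≡ true → ¬ (i ≡ x × j ≡ y) → ¬ (i ≡ y × j ≡ x) → w i j ≡ w′ i j) →
      edgeSum G w + w′ x y ≡ edgeSum G w′ + w x y
    edgeSum-update-ordered {w} {w′} {x} {y} x<y adjₓᵧ agree = begin
      edgeSum G w + w′ x y
        ≡⟨ cong₂ _+_ (edgeSum≡∑∑ w) (≡.sym (edgeTerm-edge {w = w′} x<y adjₓᵧ)) ⟩
      ∑ (λ i → ∑ (edgeTerm w i)) + edgeTerm w′ x y
        ≡⟨ ∑∑-update x y agreeing-terms ⟩
      ∑ (λ i → ∑ (edgeTerm w′ i)) + edgeTerm w x y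
        ≡⟨ cong₂ _+_ (≡.sym (edgeSum≡∑∑ w′)) (edgeTerm-edge {w = w} x<y adjₓᵧ) ⟩
      edgeSum G w′ + w x y
        ∎
      where
      open ≡-Reasoning
      agreeing-terms : ∀ i j → ¬ (i ≡ x × j ≡ y) → edgeTerm w i j ≡ edgeTerm w′ i j
      agreeing-terms i j not-xy = edgeTerm-cong {w} {w′} i j λ i<j adjᵢⱼ →
        agree i j adjᵢⱼ not-xy λ { (refl , refl) → <-asym x<y i<j }

  edgeSum-update : ∀ {w w′ x y} → (∀ i j → w i j ≡ w j i) → (∀ i j → w′ i j ≡ w′ j i) →
    adj G x y ≡ true →
    (∀ i j → adj G i j ≡ true → ¬ (i ≡ x × j ≡ y) → ¬ (i ≡ y × j ≡ x) → w i j ≡ w′ i j) →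
    edgeSum G w + w′ x y ≡ edgeSum G w′ + w x y
  edgeSum-update {w} {w′} {x} {y} w-sym w′-sym adjₓᵧ agree with <-cmp (toℕ x) (toℕ y)
  ... | tri< x<y _ _ = edgeSum-update-ordered x<y adjₓᵧ agree
  ... | tri≈ _ x≡y _ = contradiction (toℕ-injective x≡y) (adjacent⇒≢ adjₓᵧ)
  ... | tri> _ _ y<x = subst₂ (λ a b → edgeSum G w + a ≡ edgeSum G w′ + b) (w′-sym y x) (w-sym y x)
    (edgeSum-update-ordered {w} {w′} y<x (trans (sym G y x) adjₓᵧ)
      λ i j adjᵢⱼ not-yx not-xy → agree i j adjᵢⱼ not-xy not-yx)

module Cherries {A : Set} {N : ℕ} (C : Fin N → Fin N → A) where

  Outside : ∀ {k} → Vec (Fin N) k → Fin N → Set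
  Outside xs x = All (x ≢_) xs

  Monochromatic : (Fin N → Set) → A → Set
  Monochromatic P α = ∀ {x y} → P x → P y → x ≢ y → C x y ≡ α

  NearlyMonochromatic : Set
  NearlyMonochromatic = ∃₂ λ s t → s ≢ t × ∃ (Monochromatic (Outside (s ∷ t ∷ [])))

  LocallyConstant : (Fin N → Set) → Set
  LocallyConstant P = ∀ {q x y} → P q → P x → P y → q ≢ x → q ≢ y → C q x ≡ C q y

  record Cherry (P : Fin N → Set) : Set where
    constructor cherry
    field
      centre end end′ : Fin N
      centre∈P : P centre
      end∈P : P end
      end′∈P : P end′
      centre≢end : centre ≢ end
      centre≢end′ : centre ≢ end′
      bichromatic : C centre end ≢ C centre end′

  record TwoCherries : Set where
    constructor twoCherries
    field
      centre₁ end₁ end₁′ centre₂ end₂ end₂′ : Fin N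
      distinct : Unique (centre₁ ∷ end₁ ∷ end₁′ ∷ centre₂ ∷ end₂ ∷ end₂′ ∷ [])
      bichromatic₁ : C centre₁ end₁ ≢ C centre₁ end₁′
      bichromatic₂ : C centre₂ end₂ ≢ C centre₂ end₂′

  Dichotomy : Set
  Dichotomy = TwoCherries ⊎ NearlyMonochromatic

  module _ (_≟ᶜ_ : DecidableEquality A) (C-sym : ∀ x y → C x y ≡ C y x) where

    outside? : ∀ {k} (xs : Vec (Fin N) k) → Decidable (Outside xs)
    outside? xs x = all? (λ y → ¬? (x ≟ y)) xs

    cherry-or-locallyConstant : ∀ {P} → Decidable P → Cherry P ⊎ LocallyConstant P
    cherry-or-locallyConstant P? with any? (λ q → any? λ x → any? λ y →
      P? q ×-dec P? x ×-dec P? y ×-dec ¬? (q ≟ x) ×-dec ¬? (q ≟ y) ×-dec ¬? (C q x ≟ᶜ C q y))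
    ... | yes (q , x , y , q∈P , x∈P , y∈P , q≢x , q≢y , bichromatic) =
      inj₁ (cherry q x y q∈P x∈P y∈P q≢x q≢y bichromatic)
    ... | no no-cherry = inj₂ λ {q} {x} {y} q∈P x∈P y∈P q≢x q≢y →
      decidable-stable (C q x ≟ᶜ C q y) λ bichromatic →
        no-cherry (q , x , y , q∈P , x∈P , y∈P , q≢x , q≢y , bichromatic)

    locallyConstant⇒monochromatic : ∀ {P r r′} → LocallyConstant P → P r → P r′ → r ≢ r′ →
                                     Monochromatic P (C r r′)
    locallyConstant⇒monochromatic {r = r} {r′} constant r∈P r′∈P r≢r′ {x} {y} x∈P y∈P x≢y with x ≟ r
    ... | yes refl = constant r∈P y∈P r′∈P x≢y r≢r′
    ... | no x≢r = begin
      C x y  ≡⟨ constant x∈P y∈P r∈P x≢y x≢r ⟩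
      C x r  ≡⟨ C-sym x r ⟩
      C r x  ≡⟨ constant r∈P x∈P r′∈P (≢-sym x≢r) r≢r′ ⟩
      C r r′ ∎
      where open ≡-Reasoning

    monochromatic-insert : ∀ {k a α} {xs : Vec (Fin N) k} → Monochromatic (Outside (a ∷ xs)) α →
      (∀ {r} → Outside (a ∷ xs) r → C a r ≡ α) → Monochromatic (Outside xs) α
    monochromatic-insert {a = a} monochromatic a-edges {x} {y} x∉xs y∉xs x≢y with x ≟ a | y ≟ a
    ... | yes refl | _ = a-edges (≢-sym x≢y ∷ y∉xs)
    ... | no x≢a | yes refl = trans (C-sym x a) (a-edges (x≢a ∷ x∉xs))
    ... | no x≢a | no y≢a = monochromatic (x≢a ∷ x∉xs) (y≢a ∷ y∉xs) x≢y

    monochromatic-swap : ∀ {k a b α} {xs : Vec (Fin N) k} →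
      Monochromatic (Outside (a ∷ b ∷ xs)) α → Monochromatic (Outside (b ∷ a ∷ xs)) α
    monochromatic-swap monochromatic (x≢b ∷ x≢a ∷ x∉xs) (y≢b ∷ y≢a ∷ y∉xs) =
      monochromatic (x≢a ∷ x≢b ∷ x∉xs) (y≢a ∷ y≢b ∷ y∉xs)

    cherry-distinct : ∀ {p a b} → p ≢ a → p ≢ b → C p a ≢ C p b → Unique (b ∷ a ∷ p ∷ [])
    cherry-distinct {p} {a} {b} p≢a p≢b bichromatic =
      (≢-sym a≢b ∷ ≢-sym p≢b ∷ []) ∷ (≢-sym p≢a ∷ []) ∷ [] ∷ []
      where
      a≢b : a ≢ b
      a≢b = bichromatic ∘ cong (C p)

    module _ (6≤N : 6 ≤ N) where

      freshVertex : ∀ {k} (xs : Vec (Fin N) k) {k<6 : True (k <? 6)} → ∃ (Outside xs)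
      freshVertex xs {k<6} = fresh xs (<-≤-trans (toWitness k<6) 6≤N)

      -- In R = Outside (b ∷ a ∷ p ∷ []), every r ≢ s gives a cherry (b, r) at s.  If neither
      -- (p, r₁) at a nor (a, r₂) at p is a cherry, then C a r₁ = C p r₂ = C p a ≢ α, and
      -- (b, r₂) at p and (a, s) at r₁ are cherries.
      twoCherries-fromOffColourEdges : ∀ {p a b s α} → Unique (b ∷ a ∷ p ∷ []) →
        Monochromatic (Outside (b ∷ a ∷ p ∷ [])) α → C p a ≢ C p b → C p a ≢ α →
        Outside (b ∷ a ∷ p ∷ []) s → C b s ≢ α → TwoCherries
      twoCherries-fromOffColourEdges {p} {a} {b} {s} {α}
        bap-distinct monochromatic bichromatic pa≢α s∈R bs≢α
        with freshVertex (s ∷ b ∷ a ∷ p ∷ [])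
      ... | r₁ , r₁-fresh@(r₁≢s ∷ r₁∈R) with freshVertex (r₁ ∷ s ∷ b ∷ a ∷ p ∷ [])
      ... | r₂ , r₂-fresh@(_ ∷ r₂≢s ∷ r₂∈R) = cases (C a p ≟ᶜ C a r₁) (C p a ≟ᶜ C p r₂)
        where
        base-distinct : Unique (r₂ ∷ r₁ ∷ s ∷ b ∷ a ∷ p ∷ [])
        base-distinct = r₂-fresh ∷ r₁-fresh ∷ s∈R ∷ bap-distinct
        at-s : ∀ {r} → Outside (b ∷ a ∷ p ∷ []) r → s ≢ r → C s b ≢ C s r
        at-s r∈R s≢r sb≡sr = bs≢α (trans (C-sym b s) (trans sb≡sr (monochromatic s∈R r∈R s≢r)))
        cases : Dec (C a p ≡ C a r₁) → Dec (C p a ≡ C p r₂) → TwoCherries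
        cases (no ap≢ar₁) _ = twoCherries a p r₁ s b r₂
          (Unique-select base-distinct (4F ∷ 5F ∷ 1F ∷ 2F ∷ 3F ∷ 0F ∷ []))
          ap≢ar₁ (at-s r₂∈R (≢-sym r₂≢s))
        cases (yes _) (no pa≢pr₂) = twoCherries p a r₂ s b r₁
          (Unique-select base-distinct (5F ∷ 4F ∷ 0F ∷ 2F ∷ 3F ∷ 1F ∷ []))
          pa≢pr₂ (at-s r₁∈R (≢-sym r₁≢s))
        cases (yes ap≡ar₁) (yes pa≡pr₂) = twoCherries p b r₂ r₁ a s
          (Unique-select base-distinct (5F ∷ 3F ∷ 0F ∷ 1F ∷ 4F ∷ 2F ∷ [])) at-p at-r₁
          where
          open ≡-Reasoning
          at-p : C p b ≢ C p r₂
          at-p pb≡pr₂ = bichromatic (trans pa≡pr₂ (≡.sym pb≡pr₂))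
          at-r₁ : C r₁ a ≢ C r₁ s
          at-r₁ r₁a≡r₁s = pa≢α (begin
            C p a   ≡⟨ C-sym p a ⟩
            C a p   ≡⟨ ap≡ar₁ ⟩
            C a r₁  ≡⟨ C-sym a r₁ ⟩
            C r₁ a  ≡⟨ r₁a≡r₁s ⟩
            C r₁ s  ≡⟨ monochromatic r₁∈R s∈R r₁≢s ⟩
            α       ∎)

      dichotomy-fromOffColourEdge : ∀ {p a b α} → Unique (b ∷ a ∷ p ∷ []) →
        Monochromatic (Outside (b ∷ a ∷ p ∷ [])) α → C p a ≢ C p b → C p a ≢ α → Dichotomy
      dichotomy-fromOffColourEdge {p} {a} {b} {α}
        bap-distinct@(_ ∷ (a≢p ∷ []) ∷ _) monochromatic bichromatic pa≢α
        with any? (λ s → outside? (b ∷ a ∷ p ∷ []) s ×-dec ¬? (C b s ≟ᶜ α))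
      ... | yes (s , s∈R , bs≢α) =
        inj₁ (twoCherries-fromOffColourEdges bap-distinct monochromatic bichromatic pa≢α s∈R bs≢α)
      ... | no none = inj₂ (a , p , a≢p , α , monochromatic-insert monochromatic λ {r} r∈R →
        decidable-stable (C b r ≟ᶜ α) λ br≢α → none (r , r∈R , br≢α))

      dichotomy-fromMonochromaticRest : ∀ {p a b α} → Unique (b ∷ a ∷ p ∷ []) →
        Monochromatic (Outside (b ∷ a ∷ p ∷ [])) α → C p a ≢ C p b → Dichotomy
      dichotomy-fromMonochromaticRest {p} {a} {b} {α}
        bap-distinct@((b≢a ∷ b≢p ∷ []) ∷ (a≢p ∷ []) ∷ [] ∷ []) monochromatic bichromatic
        with C p a ≟ᶜ α
      ... | no pa≢α = dichotomy-fromOffColourEdge bap-distinct monochromatic bichromatic pa≢α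
      ... | yes pa≡α = dichotomy-fromOffColourEdge ((≢-sym b≢a ∷ a≢p ∷ []) ∷ (b≢p ∷ []) ∷ [] ∷ [])
        (monochromatic-swap monochromatic) (bichromatic ∘ ≡.sym)
        (λ pb≡α → bichromatic (trans pa≡α (≡.sym pb≡α)))

      dichotomy-fromCherry : ∀ {p a b} → p ≢ a → p ≢ b → C p a ≢ C p b → Dichotomy
      dichotomy-fromCherry {p} {a} {b} p≢a p≢b bichromatic
        with cherry-or-locallyConstant (outside? (b ∷ a ∷ p ∷ []))
      ... | inj₁ (cherry q x y q∈R x∈R y∈R q≢x q≢y bichromatic′) =
        inj₁ (twoCherries p a b q x y (Unique-select base-distinct (5F ∷ 4F ∷ 3F ∷ 2F ∷ 1F ∷ 0F ∷ []))
                          bichromatic bichromatic′)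
        where
        base-distinct : Unique (y ∷ x ∷ q ∷ b ∷ a ∷ p ∷ [])
        base-distinct = ((bichromatic′ ∘ cong (C q) ∘ ≡.sym) ∷ ≢-sym q≢y ∷ y∈R) ∷ (≢-sym q≢x ∷ x∈R) ∷ q∈R
                      ∷ cherry-distinct p≢a p≢b bichromatic
      ... | inj₂ constant with freshVertex (b ∷ a ∷ p ∷ [])
      ... | r₁ , r₁∈R with freshVertex (r₁ ∷ b ∷ a ∷ p ∷ [])
      ... | r₂ , (r₂≢r₁ ∷ r₂∈R) = dichotomy-fromMonochromaticRest (cherry-distinct p≢a p≢b bichromatic)
        (locallyConstant⇒monochromatic constant r₁∈R r₂∈R (≢-sym r₂≢r₁)) bichromatic

      twoCherries-or-nearlyMonochromatic : Dichotomy
      twoCherries-or-nearlyMonochromatic with cherry-or-locallyConstant (outside? [])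
      ... | inj₁ (cherry p a b _ _ _ p≢a p≢b bichromatic) = dichotomy-fromCherry p≢a p≢b bichromatic
      ... | inj₂ constant with freshVertex []
      ... | s , _ with freshVertex (s ∷ [])
      ... | t , (t≢s ∷ []) = inj₂ (s , t , ≢-sym t≢s , C s t , λ _ _ →
        locallyConstant⇒monochromatic constant [] [] (≢-sym t≢s) [] [])

open Cherries using (TwoCherries; twoCherries; NearlyMonochromatic; twoCherries-or-nearlyMonochromatic)

module _ {n N} (G : SimpleGraph n) (c : Colouring N) where

  weight : (Fin n → Fin N) → Fin n → Fin n → ℕ
  weight φ i j = toℕ (col c (φ i) (φ j))

  colourSum : (Fin n → Fin N) → ℕ
  colourSum φ = edgeSum G (weight φ)

  colourSum-moveLeaf : ∀ {φ u u′ x y z} → Pendant G u u′ → φ u ≡ x → φ u′ ≡ z →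
    colourSum φ + toℕ (col c y z) ≡ colourSum (updateAt φ u (const y)) + toℕ (col c x z)
  colourSum-moveLeaf {φ} {u} {u′} {y = y} {z} (adj-uu′ , only-u′) φu≡x φu′≡z =
    subst₂ (λ a b → colourSum φ + a ≡ colourSum φ′ + b)
      (cong toℕ (cong₂ (col c) (updateAt-updates u φ) φ′u′≡z)) (cong toℕ (cong₂ (col c) φu≡x φu′≡z))
      (edgeSum-update G (weight-sym φ) (weight-sym φ′) adj-uu′ agree)
    where
    φ′ : Fin n → Fin N
    φ′ = updateAt φ u (const y)
    weight-sym : ∀ ψ i j → weight ψ i j ≡ weight ψ j i
    weight-sym ψ i j = cong toℕ (colSym c (ψ i) (ψ j))
    φ′u′≡z : φ′ u′ ≡ z
    φ′u′≡z = trans (updateAt-minimal u′ u φ (≢-sym (adjacent⇒≢ G adj-uu′))) φu′≡z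
    agree : ∀ i j → adj G i j ≡ true → ¬ (i ≡ u × j ≡ u′) → ¬ (i ≡ u′ × j ≡ u) →
            weight φ i j ≡ weight φ′ i j
    agree i j adjᵢⱼ not-uu′ not-u′u = cong₂ (λ a b → toℕ (col c a b))
      (≡.sym (updateAt-minimal i u φ i≢u)) (≡.sym (updateAt-minimal j u φ j≢u))
      where
      i≢u : i ≢ u
      i≢u refl = not-uu′ (refl , only-u′ j adjᵢⱼ)
      j≢u : j ≢ u
      j≢u refl = not-u′u (only-u′ i (trans (sym G u i) adjᵢⱼ) , refl)

  zeroSumCopy-nearlyMonochromatic : 2 + n ≤ N → e G % 3 ≡ 0 → NearlyMonochromatic (col c) →
                                    ZeroSumCopy G c
  zeroSumCopy-nearlyMonochromatic 2+n≤N e≡0 (s , t , s≢t , α , monochromatic)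
    with embedAvoiding 2+n≤N [] [] s t [] ((s≢t ∷ []) ∷ [] ∷ [])
  ... | φ , φ-injective , _ , φ≢s , φ≢t = φ , φ-injective , (begin
    colourSum φ % 3        ≡⟨ cong (_% 3) (edgeSum-constant G (toℕ α) coloured-α) ⟩
    (toℕ α * e G) % 3      ≡⟨ n∣m⇒m%n≡0 _ 3 (∣n⇒∣m*n (toℕ α) (m%n≡0⇒n∣m (e G) 3 e≡0)) ⟩
    0                      ∎)
    where
    open ≡-Reasoning
    coloured-α : ∀ i j → adj G i j ≡ true → weight φ i j ≡ toℕ α
    coloured-α i j adjᵢⱼ = cong toℕ (monochromatic (φ≢s i ∷ φ≢t i ∷ []) (φ≢s j ∷ φ≢t j ∷ [])
                                                    (adjacent⇒≢ G adjᵢⱼ ∘ φ-injective))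

  zeroSumCopy-twoCherries : 2 + n ≤ N → ∀ {u u′ v v′} → Pendant G u u′ → Pendant G v v′ →
    Unique (u ∷ u′ ∷ v ∷ v′ ∷ []) → TwoCherries (col c) → ZeroSumCopy G c
  zeroSumCopy-twoCherries 2+n≤N {u} {u′} {v} {v′} pendant-u pendant-v
    endpoints-distinct@((_ ∷ u≢v ∷ u≢v′ ∷ []) ∷ _)
    (twoCherries c₁ e₁ e₁′ c₂ e₂ e₂′ distinct bichromatic₁ bichromatic₂) =
    fromEmbedding (embedAvoiding 2+n≤N (u ∷ u′ ∷ v ∷ v′ ∷ []) endpoints-distinct
                                 e₁′ e₂′ (e₁ ∷ c₁ ∷ e₂ ∷ c₂ ∷ [])
                                 (Unique-select distinct (2F ∷ 5F ∷ 1F ∷ 0F ∷ 4F ∷ 3F ∷ [])))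
    where
    e₁′≢e₂′ : e₁′ ≢ e₂′
    e₁′≢e₂′ eq with () ← lookup-injective distinct 2F 5F eq
    recolour : ∀ {x y} z → col c x z ≡ col c y z → col c z x ≡ col c z y
    recolour {x} {y} z eq = trans (colSym c z x) (trans eq (colSym c y z))
    fromEmbedding : EmbeddingAvoiding (u ∷ u′ ∷ v ∷ v′ ∷ []) e₁′ e₂′ (e₁ ∷ c₁ ∷ e₂ ∷ c₂ ∷ []) →
                    ZeroSumCopy G c
    fromEmbedding (φ₀ , φ₀-injective , φ₀-spec , φ₀≢e₁′ , φ₀≢e₂′) =
      copy (zeroSum-among-four (bichromatic₁ ∘ recolour c₁) (bichromatic₂ ∘ recolour c₂)
                               move-u move-v move-v′)
      where
      φ₁ φ₂ φ₃ : Fin n → Fin N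
      φ₁ = updateAt φ₀ u (const e₁′)
      φ₂ = updateAt φ₀ v (const e₂′)
      φ₃ = updateAt φ₁ v (const e₂′)
      move-u : colourSum φ₀ + toℕ (col c e₁′ c₁) ≡ colourSum φ₁ + toℕ (col c e₁ c₁)
      move-u = colourSum-moveLeaf pendant-u (φ₀-spec 0F) (φ₀-spec 1F)
      move-v : colourSum φ₀ + toℕ (col c e₂′ c₂) ≡ colourSum φ₂ + toℕ (col c e₂ c₂)
      move-v = colourSum-moveLeaf pendant-v (φ₀-spec 2F) (φ₀-spec 3F)
      move-v′ : colourSum φ₁ + toℕ (col c e₂′ c₂) ≡ colourSum φ₃ + toℕ (col c e₂ c₂)
      move-v′ = colourSum-moveLeaf pendant-v
        (trans (updateAt-minimal v u φ₀ (≢-sym u≢v)) (φ₀-spec 2F))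
        (trans (updateAt-minimal v′ u φ₀ (≢-sym u≢v′)) (φ₀-spec 3F))
      copy : colourSum φ₀ % 3 ≡ 0 ⊎ colourSum φ₁ % 3 ≡ 0 ⊎ colourSum φ₂ % 3 ≡ 0 ⊎ colourSum φ₃ % 3 ≡ 0 →
             ZeroSumCopy G c
      copy (inj₁ zero-sum) = φ₀ , φ₀-injective , zero-sum
      copy (inj₂ (inj₁ zero-sum)) = φ₁ , updateAt-injective φ₀-injective φ₀≢e₁′ , zero-sum
      copy (inj₂ (inj₂ (inj₁ zero-sum))) = φ₂ , updateAt-injective φ₀-injective φ₀≢e₂′ , zero-sum
      copy (inj₂ (inj₂ (inj₂ zero-sum))) = φ₃ , φ₃-injective , zero-sum
        where
        φ₃-injective : Injective _≡_ _≡_ φ₃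
        φ₃-injective =
          updateAt-injective (updateAt-injective φ₀-injective φ₀≢e₁′) (updateAt-avoids φ₀≢e₂′ e₁′≢e₂′)

theorem7 : (n : ℕ) (G : SimpleGraph n) → TwoGood G → e G % 3 ≡ 0 → ZeroSumRamseyAtMost G (n + 2)
theorem7 n G (u , v , degree-u , degree-v , far-apart) e≡0 N n+2≤N c
  with degree≡1⇒pendant G degree-u | degree≡1⇒pendant G degree-v
... | u′ , pendant-u | v′ , pendant-v =
  [ zeroSumCopy-twoCherries G c 2+n≤N pendant-u pendant-v distinct
  , zeroSumCopy-nearlyMonochromatic G c 2+n≤N e≡0
  ]′ (twoCherries-or-nearlyMonochromatic (col c) _≟_ (colSym c) 6≤N)
  where
  distinct : Unique (u ∷ u′ ∷ v ∷ v′ ∷ [])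
  distinct = leaves-distinct G pendant-u pendant-v far-apart
  2+n≤N : 2 + n ≤ N
  2+n≤N = subst (_≤ N) (+-comm n 2) n+2≤N
  6≤N : 6 ≤ N
  6≤N = ≤-trans (s≤s (s≤s (injective⇒≤ (λ {i} {j} → lookup-injective distinct i j)))) 2+n≤N
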